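{- Let $B=B'(p)$, let $\beta_1:=\min\{\max_{s\in S}z(s):z\in B\cap\mathbb{Z}^S\}$, and let $m$ be a $\beta_1$-covered element of $B\cap\mathbb{Z}^S$. Let $S_1(m):=\bigcup\{T_m(t):t\in S,\ m(t)=\beta_1\}$. Then $m$ is pre-decreasingly-minimal if and only if $m(s)\ge\beta_1-1$ for each $s\in S_1(m)$.
   Context: $S$ is a finite non-empty set; $p$ is a set-function on subsets of $S$ with values in $\mathbb{Z}\cup\{ -\infty\}$, $p(\emptyset)=0$, $p(S)$ finite, and supermodular: $p(X)+p(Y)\le p(X\cap Y)+p(X\cup Y)$ whenever $p(X),p(Y)$ are finite. $B'(p)=\{x\in\mathbb{R}^S:\widetilde x(S)=p(S),\ \widetilde x(Z)\ge p(Z)\ \forall Z\subset S\}$ with $\widetilde x(Z)=\sum_{s\in Z}x(s)$. A vector is $\beta$-covered if each component is at most $\beta$. For $m\in B\cap\mathbb{Z}^S$, a set $X$ is $m$-tight if $\widetilde m(X)=p(X)$; $m$-tight sets are closed under union and intersection, and $T_m(t)$ denotes the intersection of all $m$-tight sets containing $t$ (the smallest $m$-tight set containing $t$). A $\beta_1$-covered element $m$ of $B\cap\mathbb{Z}^S$ is pre-decreasingly-minimal (pre-dec-min) if the number of its components equal to $\beta_1$ is as small as possible among all $\beta_1$-covered elements of $B\cap\mathbb{Z}^S$. -}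

module Defs where

open import Data.Nat using (ℕ; zero; suc)
import Data.Nat as N
open import Data.Integer using (ℤ; _+_; _⊔_; _≤_; _-_; 0ℤ; 1ℤ)
import Data.Integer as Z
open import Data.Fin using (Fin; zero; suc)
open import Data.Fin.Subset using (Subset; _∈_; _∩_; _∪_; ⊥; ⊤)
open import Data.Vec using (_∷_; [])
open import Data.Bool using (Bool; true; false; if_then_else_)
open import Data.Product using (Σ; _×_; ∃; _,_)
open import Data.Empty renaming (⊥ to Empty)
open import Data.Unit using () renaming (⊤ to Unit)
open import Relation.Binary.PropositionalEquality using (_≡_)
open import Relation.Nullary using (yes; no)

data ℤ∞ : Set where
  -∞  : ℤ∞
  fin : ℤ → ℤ∞

_≤∞_ : ℤ∞ → ℤ∞ → Set
-∞    ≤∞ _     = Unit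
fin a ≤∞ -∞    = Empty
fin a ≤∞ fin b = a ≤ b

_+∞_ : ℤ∞ → ℤ∞ → ℤ∞
-∞    +∞ _     = -∞
fin a +∞ -∞    = -∞
fin a +∞ fin b = fin (a + b)

sumSub : ∀ {n} → (Fin n → ℤ) → Subset n → ℤ
sumSub {zero}  x []      = 0ℤ
sumSub {suc n} x (b ∷ Z) = (if b then x zero else 0ℤ) + sumSub (λ i → x (suc i)) Z

IsSupermodularSetFn : ∀ {n} → (Subset n → ℤ∞) → Set
IsSupermodularSetFn {n} p =
  (p ⊥ ≡ fin 0ℤ) × (∃ λ c → p ⊤ ≡ fin c) ×
  (∀ (X Y : Subset n) (a b : ℤ) → p X ≡ fin a → p Y ≡ fin b →
     fin (a + b) ≤∞ (p (X ∩ Y) +∞ p (X ∪ Y)))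

InB : ∀ {n} → (Subset n → ℤ∞) → (Fin n → ℤ) → Set
InB {n} p x = (fin (sumSub x ⊤) ≡ p ⊤) × (∀ (Z : Subset n) → p Z ≤∞ fin (sumSub x Z))

maxComp : ∀ {n} → (Fin (suc n) → ℤ) → ℤ
maxComp {zero}  z = z zero
maxComp {suc n} z = z zero ⊔ maxComp (λ i → z (suc i))

IsMinMax : ∀ {n} → (Subset (suc n) → ℤ∞) → ℤ → Set
IsMinMax {n} p β =
  (∃ λ (z : Fin (suc n) → ℤ) → InB p z × maxComp z ≡ β) ×
  (∀ (z : Fin (suc n) → ℤ) → InB p z → β ≤ maxComp z)

Covered : ∀ {n} → ℤ → (Fin n → ℤ) → Set
Covered {n} β x = ∀ (s : Fin n) → x s ≤ β

countEq : ∀ {n} → (Fin n → ℤ) → ℤ → ℕ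
countEq {zero}  x β = 0
countEq {suc n} x β with x zero Z.≟ β
... | yes _ = suc (countEq (λ i → x (suc i)) β)
... | no  _ = countEq (λ i → x (suc i)) β

PreDecMin : ∀ {n} → (Subset n → ℤ∞) → ℤ → (Fin n → ℤ) → Set
PreDecMin {n} p β m =
  InB p m × Covered β m ×
  (∀ (z : Fin n → ℤ) → InB p z → Covered β z → countEq m β N.≤ countEq z β)

Tight : ∀ {n} → (Subset n → ℤ∞) → (Fin n → ℤ) → Subset n → Set
Tight p m X = p X ≡ fin (sumSub m X)

InT : ∀ {n} → (Subset n → ℤ∞) → (Fin n → ℤ) → Fin n → Fin n → Set
InT {n} p m t s = ∀ (X : Subset n) → Tight p m X → t ∈ X → s ∈ X

InS1 : ∀ {n} → (Subset n → ℤ∞) → ℤ → (Fin n → ℤ) → Fin n → Set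
InS1 {n} p β m s = Σ (Fin n) λ t → (m t ≡ β) × InT p m t s

-- If m(s) < β - 1 for some s ∈ T_m(t) with m(t) = β, moving one unit from t to s stays in B'(p)
-- and removes a component equal to β, so m is not pre-dec-min. Conversely, m-tight sets form a
-- lattice, so when m ≥ β - 1 on S₁(m) there is an m-tight set Y containing every β-component of m
-- on which m ≥ β - 1. On Y a β-covered z ∈ B'(p) satisfies z ≤ β - 1 + [z = β] while
-- m ≥ β - 1 + [m = β], and z̃(Y) ≥ p(Y) = m̃(Y) then says z has at least as many β-components as m.

module Submission where

open import Defs
open import Data.Nat using (ℕ; suc; zero)
import Data.Nat as N
import Data.Nat.Properties as NP
open import Data.Integer using (ℤ; +_; _+_; -_; _-_; _≤_; _<_; 0ℤ; 1ℤ; -1ℤ; +≤+; nonNegative)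
import Data.Integer as Z
import Data.Integer.Properties as ZP
open import Data.Integer.Tactic.RingSolver using (solve-∀)
open import Algebra.Properties.CommutativeSemigroup ZP.+-commutativeSemigroup using (interchange)
open import Data.Bool using (Bool; true; false; if_then_else_)
open import Data.Fin using (Fin; zero; suc)
import Data.Fin.Properties as FP
open import Data.Fin.Subset using (Subset; _∈_; _∉_; _∩_; _∪_; ⊤; ⊥; ⋂; ⋃)
open import Data.Fin.Subset.Properties
  using (_∈?_; anySubset?; ∈⊤; ∉⊥; x∈p∩q⁺; x∈p∩q⁻; x∈p∪q⁺; x∈p∪q⁻)
open import Data.Vec.Base using (_∷_; []; here; there)
open import Data.List.Base as List using (tabulate)
open import Data.List.Relation.Unary.All using (All; []; _∷_)
import Data.List.Relation.Unary.All.Properties as All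
open import Data.List.Relation.Unary.Any using (Any; here; there)
import Data.List.Relation.Unary.Any.Properties as Any
open import Data.Product using (∃; _×_; _,_; proj₁; proj₂)
open import Data.Sum using (inj₁; inj₂; [_,_])
open import Data.Unit using (tt)
open import Function.Base using (_∘_; _∘₂_)
open import Function.Bundles using (_⇔_; mk⇔)
open import Relation.Binary.PropositionalEquality hiding ([_])
open import Relation.Nullary using (Dec; yes; no; does; ¬_; contradiction)
open import Relation.Nullary.Decidable using (_×-dec_; ¬?)
open import Relation.Unary using (Decidable)

private
  variable
    n : ℕ

-i+[i+j]≡j : ∀ i j → - i + (i + j) ≡ j
-i+[i+j]≡j = solve-∀

+-cancelˡ-≤ : ∀ k {i j} → k + i ≤ k + j → i ≤ j
+-cancelˡ-≤ k {i} {j} k+i≤k+j =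
  subst₂ _≤_ (-i+[i+j]≡j k i) (-i+[i+j]≡j k j) (ZP.+-monoʳ-≤ (- k) k+i≤k+j)

+-cancelʳ-≤ : ∀ k {i j} → i + k ≤ j + k → i ≤ j
+-cancelʳ-≤ k {i} {j} i+k≤j+k =
  +-cancelˡ-≤ k (subst₂ _≤_ (ZP.+-comm i k) (ZP.+-comm j k) i+k≤j+k)

i+1-1≡i : ∀ i → i + 1ℤ - 1ℤ ≡ i
i+1-1≡i = solve-∀

i-1+1≡i : ∀ i → i - 1ℤ + 1ℤ ≡ i
i-1+1≡i = solve-∀

<-1⇒+1< : ∀ {i j} → i < j - 1ℤ → i + 1ℤ < j
<-1⇒+1< {i} {j} i<j-1 = subst (i + 1ℤ <_) (i-1+1≡i j) (ZP.+-monoˡ-< 1ℤ i<j-1)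

<⇒≤-1 : ∀ {i j} → i < j → i ≤ j - 1ℤ
<⇒≤-1 {i} {j} i<j = subst (i ≤_) (ZP.+-comm -1ℤ j) (ZP.i<j⇒i≤pred[j] i<j)

≤-1⇒< : ∀ {i j} → i ≤ j - 1ℤ → i < j
≤-1⇒< {i} {j} i≤j-1 = ZP.i≤pred[j]⇒i<j (subst (i ≤_) (ZP.+-comm j -1ℤ) i≤j-1)

i-1≢i : ∀ i → i - 1ℤ ≢ i
i-1≢i i i-1≡i = ZP.<-irrefl i-1≡i (≤-1⇒< ZP.≤-refl)

indicator : ∀ {P : Set} → Dec P → ℤ
indicator d = if does d then 1ℤ else 0ℤ

indicator-yes : ∀ {P : Set} → P → (d : Dec P) → indicator d ≡ 1ℤ
indicator-yes _ (yes _) = refl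
indicator-yes p (no ¬p) = contradiction p ¬p

indicator-no : ∀ {P : Set} → ¬ P → (d : Dec P) → indicator d ≡ 0ℤ
indicator-no ¬p (yes p) = contradiction p ¬p
indicator-no _  (no _)  = refl

0≤indicator : ∀ {P : Set} (d : Dec P) → 0ℤ ≤ indicator d
0≤indicator (yes _) = +≤+ N.z≤n
0≤indicator (no _)  = +≤+ N.z≤n

δ : Fin n → Fin n → ℤ
δ s i = indicator (s FP.≟ i)

sumSub-cong : ∀ (f g : Fin n → ℤ) → (∀ i → f i ≡ g i) → ∀ Z → sumSub f Z ≡ sumSub g Z
sumSub-cong {zero}  f g f≗g []      = refl
sumSub-cong {suc n} f g f≗g (b ∷ Z) =
  cong₂ (λ x y → (if b then x else 0ℤ) + y) (f≗g zero) (sumSub-cong (f ∘ suc) (g ∘ suc) (f≗g ∘ suc) Z)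

sumSub-+ : ∀ (f g : Fin n → ℤ) Z → sumSub (λ i → f i + g i) Z ≡ sumSub f Z + sumSub g Z
sumSub-+ {zero}  f g []      = refl
sumSub-+ {suc n} f g (b ∷ Z) = begin
  [ b ] (f zero + g zero) + sumSub (λ i → f (suc i) + g (suc i)) Z
    ≡⟨ cong₂ _+_ (head b) (sumSub-+ (f ∘ suc) (g ∘ suc) Z) ⟩
  ([ b ] f zero + [ b ] g zero) + (sumSub (f ∘ suc) Z + sumSub (g ∘ suc) Z)
    ≡⟨ interchange ([ b ] f zero) _ _ _ ⟩
  ([ b ] f zero + sumSub (f ∘ suc) Z) + ([ b ] g zero + sumSub (g ∘ suc) Z) ∎
  where
  open ≡-Reasoning
  [_]_ : Bool → ℤ → ℤ
  [ b ] x = if b then x else 0ℤ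
  head : ∀ b → [ b ] (f zero + g zero) ≡ [ b ] f zero + [ b ] g zero
  head true  = refl
  head false = refl

sumSub-neg : ∀ (f : Fin n → ℤ) Z → sumSub (λ i → - f i) Z ≡ - sumSub f Z
sumSub-neg {zero}  f []      = refl
sumSub-neg {suc n} f (b ∷ Z) =
  trans (cong₂ _+_ (head b) (sumSub-neg (f ∘ suc) Z)) (sym (ZP.neg-distrib-+ ([ b ] f zero) _))
  where
  [_]_ : Bool → ℤ → ℤ
  [ b ] x = if b then x else 0ℤ
  head : ∀ b → [ b ] (- f zero) ≡ - [ b ] f zero
  head true  = refl
  head false = refl

sumSub-- : ∀ (f g : Fin n → ℤ) Z → sumSub (λ i → f i - g i) Z ≡ sumSub f Z - sumSub g Z
sumSub-- f g Z = trans (sumSub-+ f (λ i → - g i) Z) (cong (_+_ (sumSub f Z)) (sumSub-neg g Z))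

sumSub-mono : ∀ (f g : Fin n → ℤ) Z → (∀ {i} → i ∈ Z → f i ≤ g i) → sumSub f Z ≤ sumSub g Z
sumSub-mono {zero}  f g []          f≤g = ZP.≤-refl
sumSub-mono {suc n} f g (true ∷ Z)  f≤g =
  ZP.+-mono-≤ (f≤g here) (sumSub-mono (f ∘ suc) (g ∘ suc) Z (f≤g ∘ there))
sumSub-mono {suc n} f g (false ∷ Z) f≤g =
  ZP.+-monoʳ-≤ 0ℤ (sumSub-mono (f ∘ suc) (g ∘ suc) Z (f≤g ∘ there))

sumSub-vanishing : ∀ (f : Fin n → ℤ) Z → (∀ {i} → i ∈ Z → f i ≡ 0ℤ) → sumSub f Z ≡ 0ℤ
sumSub-vanishing {zero}  f []          f≡0 = refl
sumSub-vanishing {suc n} f (true ∷ Z)  f≡0 =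
  cong₂ _+_ (f≡0 here) (sumSub-vanishing (f ∘ suc) Z (f≡0 ∘ there))
sumSub-vanishing {suc n} f (false ∷ Z) f≡0 = cong (_+_ 0ℤ) (sumSub-vanishing (f ∘ suc) Z (f≡0 ∘ there))

sumSub-⊥ : ∀ (f : Fin n → ℤ) → sumSub f ⊥ ≡ 0ℤ
sumSub-⊥ f = sumSub-vanishing f ⊥ (λ i∈⊥ → contradiction i∈⊥ ∉⊥)

sumSub-⊤-supported : ∀ (f : Fin n → ℤ) Y → (∀ {i} → i ∉ Y → f i ≡ 0ℤ) → sumSub f ⊤ ≡ sumSub f Y
sumSub-⊤-supported {zero}  f []          f≡0 = refl
sumSub-⊤-supported {suc n} f (true ∷ Y)  f≡0 =
  cong (_+_ (f zero)) (sumSub-⊤-supported (f ∘ suc) Y (λ i∉Y → f≡0 (λ { (there i∈Y) → i∉Y i∈Y })))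
sumSub-⊤-supported {suc n} f (false ∷ Y) f≡0 =
  cong₂ _+_ (f≡0 (λ ())) (sumSub-⊤-supported (f ∘ suc) Y (λ i∉Y → f≡0 (λ { (there i∈Y) → i∉Y i∈Y })))

sumSub-≤-⊤ : ∀ (f : Fin n → ℤ) Y → (∀ i → 0ℤ ≤ f i) → sumSub f Y ≤ sumSub f ⊤
sumSub-≤-⊤ {zero}  f []          0≤f = ZP.≤-refl
sumSub-≤-⊤ {suc n} f (true ∷ Y)  0≤f = ZP.+-monoʳ-≤ (f zero) (sumSub-≤-⊤ (f ∘ suc) Y (0≤f ∘ suc))
sumSub-≤-⊤ {suc n} f (false ∷ Y) 0≤f = ZP.+-mono-≤ (0≤f zero) (sumSub-≤-⊤ (f ∘ suc) Y (0≤f ∘ suc))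

sumSub-∩-∪ : ∀ (f : Fin n → ℤ) X Y → sumSub f (X ∩ Y) + sumSub f (X ∪ Y) ≡ sumSub f X + sumSub f Y
sumSub-∩-∪ {zero}  f []      []      = refl
sumSub-∩-∪ {suc n} f (b ∷ X) (c ∷ Y) = begin
  ([ b ∧ c ] + sumSub f′ (X ∩ Y)) + ([ b ∨ c ] + sumSub f′ (X ∪ Y))
    ≡⟨ interchange [ b ∧ c ] _ [ b ∨ c ] _ ⟩
  ([ b ∧ c ] + [ b ∨ c ]) + (sumSub f′ (X ∩ Y) + sumSub f′ (X ∪ Y))
    ≡⟨ cong₂ _+_ (head b c) (sumSub-∩-∪ f′ X Y) ⟩
  ([ b ] + [ c ]) + (sumSub f′ X + sumSub f′ Y)
    ≡⟨ interchange [ b ] [ c ] _ _ ⟩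
  ([ b ] + sumSub f′ X) + ([ c ] + sumSub f′ Y) ∎
  where
  open ≡-Reasoning
  open Data.Bool using (_∧_; _∨_)
  f′ : Fin n → ℤ
  f′ = f ∘ suc
  [_] : Bool → ℤ
  [ b ] = if b then f zero else 0ℤ
  head : ∀ b c → [ b ∧ c ] + [ b ∨ c ] ≡ [ b ] + [ c ]
  head true  true  = refl
  head true  false = ZP.+-comm 0ℤ (f zero)
  head false true  = refl
  head false false = refl

sumSub-δ : ∀ (t : Fin n) Z → sumSub (δ t) Z ≡ indicator (t ∈? Z)
sumSub-δ zero    (true ∷ Z)  = cong (_+_ 1ℤ) (sumSub-vanishing _ Z (λ _ → refl))
sumSub-δ zero    (false ∷ Z) = cong (_+_ 0ℤ) (sumSub-vanishing _ Z (λ _ → refl))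
sumSub-δ (suc t) (true ∷ Z)  = trans (ZP.+-identityˡ _) (sumSub-δ t Z)
sumSub-δ (suc t) (false ∷ Z) = trans (ZP.+-identityˡ _) (sumSub-δ t Z)

+countEq≡sumSub : ∀ (x : Fin n → ℤ) β → + countEq x β ≡ sumSub (λ i → indicator (x i Z.≟ β)) ⊤
+countEq≡sumSub {zero}  x β = refl
+countEq≡sumSub {suc n} x β with x zero Z.≟ β
... | yes _ = cong (_+_ 1ℤ) (+countEq≡sumSub (x ∘ suc) β)
... | no  _ = trans (+countEq≡sumSub (x ∘ suc) β) (sym (ZP.+-identityˡ _))

fin-injective : ∀ {a b} → fin a ≡ fin b → a ≡ b
fin-injective refl = refl

_≟∞_ : (u v : ℤ∞) → Dec (u ≡ v)
-∞    ≟∞ -∞    = yes refl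
-∞    ≟∞ fin _ = no λ ()
fin _ ≟∞ -∞    = no λ ()
fin a ≟∞ fin b with a Z.≟ b
... | yes a≡b = yes (cong fin a≡b)
... | no  a≢b = no (a≢b ∘ fin-injective)

≤∞-fin-trans : ∀ u {a b} → u ≤∞ fin a → a ≤ b → u ≤∞ fin b
≤∞-fin-trans -∞      _   _   = tt
≤∞-fin-trans (fin _) u≤a a≤b = ZP.≤-trans u≤a a≤b

≤∞∧≢⇒≤∞-1 : ∀ u {a} → u ≤∞ fin a → u ≢ fin a → u ≤∞ fin (a - 1ℤ)
≤∞∧≢⇒≤∞-1 -∞      _   _   = tt
≤∞∧≢⇒≤∞-1 (fin _) u≤a u≢a = <⇒≤-1 (ZP.≤∧≢⇒< u≤a (u≢a ∘ cong fin))

+∞-squeeze : ∀ u v {c d} → u ≤∞ fin c → v ≤∞ fin d → fin (c + d) ≤∞ (u +∞ v) →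
  u ≡ fin c × v ≡ fin d
+∞-squeeze -∞      _       _ _ ()
+∞-squeeze (fin _) -∞      _ _ ()
+∞-squeeze (fin u) (fin v) {c} {d} u≤c v≤d c+d≤u+v =
  cong fin (ZP.≤-antisym u≤c c≤u) , cong fin (ZP.≤-antisym v≤d d≤v)
  where
  c≤u : c ≤ u
  c≤u = +-cancelʳ-≤ d (ZP.≤-trans c+d≤u+v (ZP.+-monoʳ-≤ u v≤d))
  d≤v : d ≤ v
  d≤v = +-cancelˡ-≤ c (ZP.≤-trans c+d≤u+v (ZP.+-monoˡ-≤ v u≤c))

∈⋂⁺ : ∀ {x : Fin n} {Xs} → All (x ∈_) Xs → x ∈ ⋂ Xs
∈⋂⁺ []           = ∈⊤
∈⋂⁺ (x∈X ∷ x∈Xs) = x∈p∩q⁺ (x∈X , ∈⋂⁺ x∈Xs)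

∈⋂⁻ : ∀ {x : Fin n} Xs → x ∈ ⋂ Xs → All (x ∈_) Xs
∈⋂⁻ List.[]       _     = []
∈⋂⁻ (X List.∷ Xs) x∈X∩ with x∈p∩q⁻ X (⋂ Xs) x∈X∩
... | x∈X , x∈⋂Xs = x∈X ∷ ∈⋂⁻ Xs x∈⋂Xs

∈⋃⁺ : ∀ {x : Fin n} {Xs} → Any (x ∈_) Xs → x ∈ ⋃ Xs
∈⋃⁺ (here x∈X)    = x∈p∪q⁺ (inj₁ x∈X)
∈⋃⁺ (there x∈Xs)  = x∈p∪q⁺ (inj₂ (∈⋃⁺ x∈Xs))

∈⋃⁻ : ∀ {x : Fin n} Xs → x ∈ ⋃ Xs → Any (x ∈_) Xs
∈⋃⁻ List.[]       x∈⊥  = contradiction x∈⊥ ∉⊥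
∈⋃⁻ (X List.∷ Xs) x∈X∪ = [ here , there ∘ ∈⋃⁻ Xs ] (x∈p∪q⁻ X (⋃ Xs) x∈X∪)

module Lattice {P : Subset n → Set} (P⊥ : P ⊥) (P⊤ : P ⊤)
  (P-∩ : ∀ {X Y} → P X → P Y → P (X ∩ Y)) (P-∪ : ∀ {X Y} → P X → P Y → P (X ∪ Y)) where

  P-⋂ : ∀ {Xs} → All P Xs → P (⋂ Xs)
  P-⋂ []           = P⊤
  P-⋂ (PX ∷ PXs) = P-∩ PX (P-⋂ PXs)

  P-⋃ : ∀ {Xs} → All P Xs → P (⋃ Xs)
  P-⋃ []         = P⊥
  P-⋃ (PX ∷ PXs) = P-∪ PX (P-⋃ PXs)

  record Separator (A B : Fin n → Set) (t s : Fin n) : Set where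
    field
      set    : Subset n
      closed : P set
      ∋t     : A t → t ∈ set
      ∌s     : B s → s ∉ set

  separate : ∀ {A B : Fin n → Set} → Decidable A → Decidable B →
    (∀ {t s} → A t → B s → ∃ λ X → P X × t ∈ X × s ∉ X) →
    ∃ λ Y → P Y × (∀ {t} → A t → t ∈ Y) × (∀ {s} → B s → s ∉ Y)
  separate {A} {B} A? B? sep =
    Y , P-⋃ (All.tabulate⁺ λ t → P-⋂ (All.tabulate⁺ (closed ∘ S t))) , A⊆Y , B∩Y=∅
    where
    open Separator
    S : ∀ t s → Separator A B t s
    S t s with A? t | B? s
    ... | no ¬a | _     =
      record { set = ⊥ ; closed = P⊥ ; ∋t = λ a → contradiction a ¬a ; ∌s = λ _ → ∉⊥ }
    ... | yes _ | no ¬b =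
      record { set = ⊤ ; closed = P⊤ ; ∋t = λ _ → ∈⊤ ; ∌s = λ b → contradiction b ¬b }
    ... | yes a | yes b with sep a b
    ...   | X , PX , t∈X , s∉X = record { set = X ; closed = PX ; ∋t = λ _ → t∈X ; ∌s = λ _ → s∉X }
    Yₜ : Fin n → Subset n
    Yₜ t = ⋂ (tabulate (set ∘ S t))
    Y : Subset n
    Y = ⋃ (tabulate Yₜ)
    A⊆Y : ∀ {t} → A t → t ∈ Y
    A⊆Y {t} a = ∈⋃⁺ (Any.tabulate⁺ t (∈⋂⁺ (All.tabulate⁺ λ s → ∋t (S t s) a)))
    B∩Y=∅ : ∀ {s} → B s → s ∉ Y
    B∩Y=∅ {s} b s∈Y with Any.tabulate⁻ (∈⋃⁻ (tabulate Yₜ) s∈Y)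
    ... | t , s∈Yₜ = ∌s (S t s) b (All.tabulate⁻ (∈⋂⁻ (tabulate (set ∘ S t)) s∈Yₜ) s)

module TightSets {p : Subset n → ℤ∞} (supermodular : IsSupermodularSetFn p)
  {m : Fin n → ℤ} (m∈B : InB p m) where

  Tight? : ∀ X → Dec (Tight p m X)
  Tight? X = p X ≟∞ fin (sumSub m X)

  Tight-⊥ : Tight p m ⊥
  Tight-⊥ = trans (proj₁ supermodular) (cong fin (sym (sumSub-⊥ m)))

  Tight-⊤ : Tight p m ⊤
  Tight-⊤ = sym (proj₁ m∈B)

  Tight-∩-∪ : ∀ {X Y} → Tight p m X → Tight p m Y → Tight p m (X ∩ Y) × Tight p m (X ∪ Y)
  Tight-∩-∪ {X} {Y} X-tight Y-tight =
    +∞-squeeze (p (X ∩ Y)) (p (X ∪ Y)) (proj₂ m∈B (X ∩ Y)) (proj₂ m∈B (X ∪ Y))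
      (subst (λ a → fin a ≤∞ (p (X ∩ Y) +∞ p (X ∪ Y))) (sym (sumSub-∩-∪ m X Y))
        (proj₂ (proj₂ supermodular) X Y _ _ X-tight Y-tight))

  open Lattice {P = Tight p m} Tight-⊥ Tight-⊤ (proj₁ ∘₂ Tight-∩-∪) (proj₂ ∘₂ Tight-∩-∪)
    using (separate)

  ∉T⇒separated : ∀ {t s} → ¬ InT p m t s → ∃ λ X → Tight p m X × t ∈ X × s ∉ X
  ∉T⇒separated {t} {s} s∉Tt with anySubset? (λ X → Tight? X ×-dec t ∈? X ×-dec ¬? (s ∈? X))
  ... | yes separated  = separated
  ... | no ¬separated = contradiction s∈Tt s∉Tt
    where
    s∈Tt : InT p m t s
    s∈Tt X X-tight t∈X with s ∈? X
    ... | yes s∈X = s∈X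
    ... | no  s∉X = contradiction (X , X-tight , t∈X , s∉X) ¬separated

  S₁-bounded⇒tight-cover : ∀ {β} → (∀ s → InS1 p β m s → β - 1ℤ ≤ m s) →
    ∃ λ Y → Tight p m Y × (∀ {t} → m t ≡ β → t ∈ Y) × (∀ {s} → s ∈ Y → β - 1ℤ ≤ m s)
  S₁-bounded⇒tight-cover {β} S₁-bounded =
    let Y , Y-tight , maxima⊆Y , Y∌low = separate (λ t → m t Z.≟ β) (λ s → m s ZP.<? β - 1ℤ)
          λ mt≡β ms<β-1 → ∉T⇒separated λ s∈Tt → ZP.<⇒≱ ms<β-1 (S₁-bounded _ (_ , mt≡β , s∈Tt))
    in Y , Y-tight , maxima⊆Y , λ s∈Y → ZP.≮⇒≥ λ ms<β-1 → Y∌low ms<β-1 s∈Y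

pred+indicator≤ : ∀ β {x} → β - 1ℤ ≤ x → β - 1ℤ + indicator (x Z.≟ β) ≤ x
pred+indicator≤ β {x} β-1≤x with x Z.≟ β
... | yes refl = ZP.≤-reflexive (i-1+1≡i x)
... | no _ = subst (_≤ x) (sym (ZP.+-identityʳ _)) β-1≤x

≤pred+indicator : ∀ β {x} → x ≤ β → x ≤ β - 1ℤ + indicator (x Z.≟ β)
≤pred+indicator β {x} x≤β with x Z.≟ β
... | yes refl = ZP.≤-reflexive (sym (i-1+1≡i x))
... | no x≢β = subst (x ≤_) (sym (ZP.+-identityʳ _)) (<⇒≤-1 (ZP.≤∧≢⇒< x≤β x≢β))

countEq-≤-via-tight : ∀ {p : Subset n → ℤ∞} {m z : Fin n → ℤ} β Y → Tight p m Y →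
  (∀ {t} → m t ≡ β → t ∈ Y) → (∀ {s} → s ∈ Y → β - 1ℤ ≤ m s) →
  InB p z → Covered β z → countEq m β N.≤ countEq z β
countEq-≤-via-tight {n} {p} {m} {z} β Y Y-tight maxima⊆Y Y-high z∈B z-covered = ZP.drop‿+≤+ (begin
  + countEq m β   ≡⟨ +countEq≡sumSub m β ⟩
  sumSub [m≡β] ⊤  ≡⟨ sumSub-⊤-supported [m≡β] Y (λ i∉Y → indicator-no (i∉Y ∘ maxima⊆Y) (m _ Z.≟ β)) ⟩
  sumSub [m≡β] Y  ≤⟨ +-cancelˡ-≤ (sumSub β-1 Y) count-on-Y ⟩
  sumSub [z≡β] Y  ≤⟨ sumSub-≤-⊤ [z≡β] Y (λ i → 0≤indicator (z i Z.≟ β)) ⟩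
  sumSub [z≡β] ⊤  ≡⟨ +countEq≡sumSub z β ⟨
  + countEq z β   ∎)
  where
  open ZP.≤-Reasoning
  β-1 [m≡β] [z≡β] : Fin n → ℤ
  β-1 _ = β - 1ℤ
  [m≡β] i = indicator (m i Z.≟ β)
  [z≡β] i = indicator (z i Z.≟ β)
  count-on-Y : sumSub β-1 Y + sumSub [m≡β] Y ≤ sumSub β-1 Y + sumSub [z≡β] Y
  count-on-Y = begin
    sumSub β-1 Y + sumSub [m≡β] Y          ≡⟨ sumSub-+ β-1 [m≡β] Y ⟨
    sumSub (λ i → β - 1ℤ + [m≡β] i) Y      ≤⟨ sumSub-mono _ m Y (pred+indicator≤ β ∘ Y-high) ⟩
    sumSub m Y                             ≤⟨ subst (_≤∞ fin (sumSub z Y)) Y-tight (proj₂ z∈B Y) ⟩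
    sumSub z Y                             ≤⟨ sumSub-mono z _ Y (λ {i} _ → ≤pred+indicator β (z-covered i)) ⟩
    sumSub (λ i → β - 1ℤ + [z≡β] i) Y      ≡⟨ sumSub-+ β-1 [z≡β] Y ⟩
    sumSub β-1 Y + sumSub [z≡β] Y          ∎

exchange : (Fin n → ℤ) → Fin n → Fin n → Fin n → ℤ
exchange m s t i = m i + δ s i - δ t i

sumSub-exchange : ∀ (m : Fin n → ℤ) s t Z →
  sumSub (exchange m s t) Z ≡ sumSub m Z + indicator (s ∈? Z) - indicator (t ∈? Z)
sumSub-exchange m s t Z = trans (sumSub-- (λ i → m i + δ s i) (δ t) Z)
  (cong₂ _-_ (trans (sumSub-+ m (δ s) Z) (cong (_+_ (sumSub m Z)) (sumSub-δ s Z))) (sumSub-δ t Z))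

exchange-at-s : ∀ (m : Fin n → ℤ) {s t} → s ≢ t → exchange m s t s ≡ m s + 1ℤ
exchange-at-s m {s} {t} s≢t =
  trans (cong₂ (λ a b → m s + a - b)
               (indicator-yes refl (s FP.≟ s)) (indicator-no (s≢t ∘ sym) (t FP.≟ s)))
        (ZP.+-identityʳ (m s + 1ℤ))

exchange-at-t : ∀ (m : Fin n → ℤ) {s t} → s ≢ t → exchange m s t t ≡ m t - 1ℤ
exchange-at-t m {s} {t} s≢t =
  trans (cong₂ (λ a b → m t + a - b) (indicator-no s≢t (s FP.≟ t)) (indicator-yes refl (t FP.≟ t)))
        (cong (_- 1ℤ) (ZP.+-identityʳ (m t)))

exchange-elsewhere : ∀ (m : Fin n → ℤ) {s t i} → i ≢ s → i ≢ t → exchange m s t i ≡ m i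
exchange-elsewhere m {s} {t} {i} i≢s i≢t =
  trans (cong₂ (λ a b → m i + a - b)
               (indicator-no (i≢s ∘ sym) (s FP.≟ i)) (indicator-no (i≢t ∘ sym) (t FP.≟ i)))
        (trans (ZP.+-identityʳ _) (ZP.+-identityʳ (m i)))

-- Only the constraints of sets containing t but not s tighten, and those sets are not tight.
exchange-∈B : ∀ {p : Subset n → ℤ∞} {m s t} → InB p m → InT p m t s → InB p (exchange m s t)
exchange-∈B {p = p} {m} {s} {t} (m-total , m≥p) s∈Tt = total , ≥p
  where
  total : fin (sumSub (exchange m s t) ⊤) ≡ p ⊤
  total = trans (cong fin (begin
    sumSub (exchange m s t) ⊤                             ≡⟨ sumSub-exchange m s t ⊤ ⟩
    sumSub m ⊤ + indicator (s ∈? ⊤) - indicator (t ∈? ⊤) ≡⟨ cong₂ (λ a b → sumSub m ⊤ + a - b)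
                                                              (indicator-yes ∈⊤ (s ∈? ⊤))
                                                              (indicator-yes ∈⊤ (t ∈? ⊤)) ⟩
    sumSub m ⊤ + 1ℤ - 1ℤ                                  ≡⟨ i+1-1≡i (sumSub m ⊤) ⟩
    sumSub m ⊤                                            ∎)) m-total
    where open ≡-Reasoning
  ≥p : ∀ Z → p Z ≤∞ fin (sumSub (exchange m s t) Z)
  ≥p Z rewrite sumSub-exchange m s t Z with t ∈? Z | s ∈? Z
  ... | yes _   | yes _   = ≤∞-fin-trans (p Z) (m≥p Z) (ZP.≤-reflexive (sym (i+1-1≡i (sumSub m Z))))
  ... | yes t∈Z | no  s∉Z = subst (λ a → p Z ≤∞ fin (a - 1ℤ)) (sym (ZP.+-identityʳ (sumSub m Z)))
                              (≤∞∧≢⇒≤∞-1 (p Z) (m≥p Z) (λ Z-tight → s∉Z (s∈Tt Z Z-tight t∈Z)))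
  ... | no  _   | s∈?Z    = ≤∞-fin-trans (p Z) (m≥p Z) (ZP.≤-trans
      (ZP.i≤i+j (sumSub m Z) (indicator s∈?Z) {{nonNegative (0≤indicator s∈?Z)}})
      (ZP.≤-reflexive (sym (ZP.+-identityʳ _))))

exchange-covered : ∀ {β} {m : Fin n → ℤ} {s} t → Covered β m → m s + 1ℤ ≤ β → Covered β (exchange m s t)
exchange-covered {n} {β} {m} {s} t m≤β ms+1≤β i =
  ZP.≤-trans (ZP.i-j≤i (m i + δ s i) (δ t i) {{nonNegative (0≤indicator (t FP.≟ i))}})
             (bound (s FP.≟ i))
  where
  bound : (d : Dec (s ≡ i)) → m i + indicator d ≤ β
  bound (yes refl) = ms+1≤β
  bound (no _)     = subst (_≤ β) (sym (ZP.+-identityʳ (m i))) (m≤β i)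

countEq-exchange : ∀ {β} (m : Fin n → ℤ) s t → m t ≡ β → m s + 1ℤ < β →
  suc (countEq (exchange m s t) β) ≡ countEq m β
countEq-exchange {n} {β} m s t mt≡β ms+1<β = ZP.+-injective (begin
  1ℤ + + countEq z β                    ≡⟨ cong₂ _+_ (sym (indicator-yes ∈⊤ (t ∈? ⊤))) (+countEq≡sumSub z β) ⟩
  indicator (t ∈? ⊤) + sumSub [z≡β] ⊤   ≡⟨ cong (_+ sumSub [z≡β] ⊤) (sumSub-δ t ⊤) ⟨
  sumSub (δ t) ⊤ + sumSub [z≡β] ⊤       ≡⟨ sumSub-+ (δ t) [z≡β] ⊤ ⟨
  sumSub (λ i → δ t i + [z≡β] i) ⊤      ≡⟨ sumSub-cong _ _ pointwise ⊤ ⟩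
  sumSub (λ i → indicator (m i Z.≟ β)) ⊤ ≡⟨ +countEq≡sumSub m β ⟨
  + countEq m β                         ∎)
  where
  open ≡-Reasoning
  z : Fin n → ℤ
  z = exchange m s t
  [z≡β] : Fin n → ℤ
  [z≡β] i = indicator (z i Z.≟ β)
  ms<β : m s < β
  ms<β = ZP.suc[i]≤j⇒i<j (subst (_≤ β) (ZP.+-comm (m s) 1ℤ) (ZP.<⇒≤ ms+1<β))
  s≢t : s ≢ t
  s≢t refl = ZP.<-irrefl mt≡β ms<β
  zt≢β : z t ≢ β
  zt≢β zt≡β = i-1≢i β (trans (sym (trans (exchange-at-t m s≢t) (cong (_- 1ℤ) mt≡β))) zt≡β)
  zs≢β : z s ≢ β
  zs≢β = ZP.<⇒≢ (subst (_< β) (sym (exchange-at-s m s≢t)) ms+1<β)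
  pointwise : ∀ i → δ t i + [z≡β] i ≡ indicator (m i Z.≟ β)
  pointwise i with i FP.≟ t | i FP.≟ s
  ... | yes refl | _        =
    trans (cong₂ _+_ (indicator-yes refl (t FP.≟ t)) (indicator-no zt≢β (z t Z.≟ β)))
          (sym (indicator-yes mt≡β (m t Z.≟ β)))
  ... | no i≢t   | yes refl =
    trans (cong₂ _+_ (indicator-no (i≢t ∘ sym) (t FP.≟ s)) (indicator-no zs≢β (z s Z.≟ β)))
          (sym (indicator-no (ZP.<⇒≢ ms<β) (m s Z.≟ β)))
  ... | no i≢t   | no i≢s   =
    trans (cong₂ _+_ (indicator-no (i≢t ∘ sym) (t FP.≟ i))
                     (cong (λ v → indicator (v Z.≟ β)) (exchange-elsewhere m i≢s i≢t)))
          (ZP.+-identityˡ _)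

pre-dec-min⇒S₁-bounded : ∀ {p : Subset n → ℤ∞} {β m} → PreDecMin p β m →
  ∀ s → InS1 p β m s → β - 1ℤ ≤ m s
pre-dec-min⇒S₁-bounded {β = β} {m} (m∈B , m-covered , minimal) s (t , mt≡β , s∈Tt) =
  ZP.≮⇒≥ λ ms<β-1 →
    let ms+1<β = <-1⇒+1< ms<β-1
        z = exchange m s t
        fewer = countEq-exchange m s t mt≡β ms+1<β
        not-fewer = minimal z (exchange-∈B m∈B s∈Tt) (exchange-covered t m-covered (ZP.<⇒≤ ms+1<β))
    in NP.<-irrefl refl (subst (N._≤ countEq z β) (sym fewer) not-fewer)

S₁-bounded⇒pre-dec-min : ∀ {p : Subset n → ℤ∞} {β m} → IsSupermodularSetFn p → InB p m → Covered β m →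
  (∀ s → InS1 p β m s → β - 1ℤ ≤ m s) → PreDecMin p β m
S₁-bounded⇒pre-dec-min {β = β} supermodular m∈B m-covered S₁-bounded =
  let Y , Y-tight , maxima⊆Y , Y-bounded = TightSets.S₁-bounded⇒tight-cover supermodular m∈B S₁-bounded
  in m∈B , m-covered , λ z z∈B z-covered →
       countEq-≤-via-tight β Y Y-tight maxima⊆Y Y-bounded z∈B z-covered

theorem4p2 : (n : ℕ) (p : Subset (suc n) → ℤ∞) → IsSupermodularSetFn p →
    (β₁ : ℤ) → IsMinMax p β₁ →
    (m : Fin (suc n) → ℤ) → InB p m → Covered β₁ m →
    PreDecMin p β₁ m ⇔ (∀ (s : Fin (suc n)) → InS1 p β₁ m s → β₁ - 1ℤ ≤ m s)
theorem4p2 n p supermodular β₁ _ m m∈B m-covered =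
  mk⇔ pre-dec-min⇒S₁-bounded (S₁-bounded⇒pre-dec-min supermodular m∈B m-covered)
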